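{- Let $M=(a_{i,j})_{1\leq i,j\leq n}$ be a Steinhaus matrix of size $n\geq3$. Then the following are equivalent: (i) $M$ is multi-symmetric; (ii) the first row $(a_{1,2},\ldots,a_{1,n})$, the last column $(a_{1,n},\ldots,a_{n-1,n})$ and the over-diagonal $(a_{1,2},a_{2,3},\ldots,a_{n-1,n})$ of $M$ are symmetric sequences; (iii) the entries $a_{i,n-i+1}$, $a_{n-2i+1,n-i+1}$ and $a_{i,2i}$ vanish for all $1\leq i\leq\left\lfloor\frac{n-1}{2} \right\rfloor$.
   Context: A Steinhaus matrix of size $n\geq1$ is a matrix $M=(a_{i,j})_{1\leq i,j\leq n}$ with entries in $\mathbb{F}_2=\{0,1\}$ such that $a_{i,i}=0$ for all $i$, $a_{i,j}=a_{i-1,j-1}+a_{i-1,j}$ (addition in $\mathbb{F}_2$) for all $2\leq i<j\leq n$, and $a_{i,j}=a_{j,i}$ for all $i,j$. A square matrix $(a_{i,j})$ of size $n$ is doubly-symmetric if $a_{i,j}=a_{j,i}=a_{n-j+1,n-i+1}$ for all $1\leq i,j\leq n$; it is multi-symmetric if it is doubly-symmetric and $a_{i,j}=a_{i,n-j+i+1}$ for all $1\leq i<j\leq n$. A sequence $(x_1,\ldots,x_m)$ is symmetric if $x_k=x_{m-k+1}$ for all $k$. -}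

module Defs where

open import Data.Bool using (Bool; true; false; _xor_)
open import Data.Nat using (ℕ; zero; suc; _+_; _*_; _∸_; _≤_; _<_; _/_)
open import Data.Product using (_×_)
open import Relation.Binary.PropositionalEquality using (_≡_)

-- Matrices over F₂ = Bool (xor = addition), with 1-based indices.
-- Only the entries M i j with 1 ≤ i, j ≤ n are meaningful; all conditions
-- below only ever refer to those entries.
Matrix : Set
Matrix = ℕ → ℕ → Bool

record Steinhaus (n : ℕ) (M : Matrix) : Set where
  field
    diag  : ∀ i → 1 ≤ i → i ≤ n → M i i ≡ false
    rule  : ∀ i j → 2 ≤ i → i < j → j ≤ n →
            M i j ≡ M (i ∸ 1) (j ∸ 1) xor M (i ∸ 1) j
    symm  : ∀ i j → 1 ≤ i → i ≤ n → 1 ≤ j → j ≤ n → M i j ≡ M j i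

DoublySymmetric : ℕ → Matrix → Set
DoublySymmetric n M =
  ∀ i j → 1 ≤ i → i ≤ n → 1 ≤ j → j ≤ n →
    (M i j ≡ M j i) × (M i j ≡ M (n + 1 ∸ j) (n + 1 ∸ i))

MultiSymmetric : ℕ → Matrix → Set
MultiSymmetric n M =
  DoublySymmetric n M ×
  (∀ i j → 1 ≤ i → i < j → j ≤ n → M i j ≡ M i (n ∸ j + i + 1))

SymmetricSeq : ℕ → (ℕ → Bool) → Set
SymmetricSeq m x = ∀ k → 1 ≤ k → k ≤ m → x k ≡ x (m + 1 ∸ k)

firstRow : Matrix → ℕ → Bool
firstRow M k = M 1 (k + 1)

lastColumn : ℕ → Matrix → ℕ → Bool
lastColumn n M k = M k n

overDiagonal : Matrix → ℕ → Bool
overDiagonal M k = M k (k + 1)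

ConditionII : ℕ → Matrix → Set
ConditionII n M =
  SymmetricSeq (n ∸ 1) (firstRow M) ×
  SymmetricSeq (n ∸ 1) (lastColumn n M) ×
  SymmetricSeq (n ∸ 1) (overDiagonal M)

ConditionIII : ℕ → Matrix → Set
ConditionIII n M =
  ∀ i → 1 ≤ i → i ≤ (n ∸ 1) / 2 →
    (M i (n + 1 ∸ i) ≡ false) ×
    (M (n + 1 ∸ 2 * i) (n + 1 ∸ i) ≡ false) ×
    (M i (2 * i) ≡ false)

-- The Steinhaus rule makes the strict upper triangle of M a Pascal triangle
-- over F₂, and so is its rotation (i, j) ↦ a_{j−i,j}. The reflection
-- (i, j) ↦ (n+1−j, n+1−i) of a Pascal triangle is again one, and a Pascal
-- triangle is determined by its superdiagonal, and above the antidiagonal also by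
-- the two antidiagonals i + j = n, n + 1. So a Pascal triangle is invariant under
-- the reflection iff its superdiagonal is a palindrome, iff its entries
-- T_{i,n+1−i} vanish (which is what makes the line i + j = n agree with its
-- reflection). Double symmetry and the row symmetry a_{i,j} = a_{i,n−j+i+1} are
-- exactly this invariance for M and for its rotation, whose superdiagonals are
-- the over-diagonal and the first row; the last column and the entries a_{i,2i}
-- are then handled by composing the two symmetries.
module Submission where

open import Defs
open import Data.Bool using (Bool; false; _xor_)
open import Data.Bool.Properties using (xor-assoc; xor-comm; xor-same; xor-identityʳ)
open import Data.Empty using (⊥-elim)
open import Data.Nat using (ℕ; zero; suc; _+_; _*_; _∸_; _≤_; _<_; _/_; z≤n; s≤s; s≤s⁻¹; _≤?_)
open import Data.Nat.DivMod using (m*n/n≡m; m/n*n≤m; /-monoˡ-≤)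
open import Data.Nat.Properties
open import Data.Product using (_×_; _,_; proj₁; proj₂)
open import Function.Bundles using (_⇔_; mk⇔; Equivalence)
open import Relation.Binary.PropositionalEquality
open import Relation.Nullary using (yes; no)
open import Relation.Binary.Definitions using (Tri; tri<; tri≈; tri>)

xor-transpose : ∀ {a b c} → a ≡ b xor c → b ≡ a xor c
xor-transpose {b = b} {c} refl = sym (begin
  (b xor c) xor c  ≡⟨ xor-assoc b c c ⟩
  b xor (c xor c)  ≡⟨ cong (b xor_) (xor-same c) ⟩
  b xor false      ≡⟨ xor-identityʳ b ⟩
  b                ∎)
  where open ≡-Reasoning

n+1∸ : ∀ n k → n + 1 ∸ k ≡ suc n ∸ k
n+1∸ n k = cong (_∸ k) (+-comm n 1)

1+n∸ : ∀ {m n} → n ≤ m → suc m ∸ n ≡ suc (m ∸ n)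
1+n∸ = +-∸-assoc 1

1≤1+n∸i : ∀ {n i} → i ≤ n → 1 ≤ suc n ∸ i
1≤1+n∸i i≤n = m<n⇒0<n∸m (s≤s i≤n)

1+n∸i≤n : ∀ {n i} → 1 ≤ i → suc n ∸ i ≤ n
1+n∸i≤n {n} {suc i} _ = m∸n≤m n i

2*i≡i+i : ∀ i → 2 * i ≡ i + i
2*i≡i+i i = cong (i +_) (+-identityʳ i)

≤-half⇔ : ∀ {n i} → 1 ≤ n → i ≤ (n ∸ 1) / 2 ⇔ i + i < n
≤-half⇔ {suc n} {i} _ = mk⇔
  (λ i≤n/2 → s≤s (subst (_≤ n) i*2≡i+i (≤-trans (*-monoˡ-≤ 2 i≤n/2) (m/n*n≤m n 2))))
  (λ { (s≤s i+i≤n) →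
    subst (_≤ n / 2) (m*n/n≡m i 2) (/-monoˡ-≤ 2 (subst (_≤ n) (sym i*2≡i+i) i+i≤n)) })
  where
  i*2≡i+i : i * 2 ≡ i + i
  i*2≡i+i = trans (*-comm i 2) (2*i≡i+i i)

Pascal : ℕ → Matrix → Set
Pascal n T = ∀ i j → 1 ≤ i → i < j → suc j ≤ n → T (suc i) (suc j) ≡ T i j xor T i (suc j)

pascal-right : ∀ {n T} → Pascal n T →
  ∀ i j → 1 ≤ i → i < j → suc j ≤ n → T i (suc j) ≡ T i j xor T (suc i) (suc j)
pascal-right {T = T} pascal i j 1≤i i<j j<n =
  trans (xor-transpose (trans (pascal i j 1≤i i<j j<n) (xor-comm (T i j) (T i (suc j)))))
        (xor-comm (T (suc i) (suc j)) (T i j))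

AgreeOnTriangle : ℕ → Matrix → Matrix → Set
AgreeOnTriangle n T U = ∀ i j → 1 ≤ i → i < j → j ≤ n → T i j ≡ U i j

reflect : ℕ → Matrix → Matrix
reflect n T i j = T (suc n ∸ j) (suc n ∸ i)

AntidiagonalSymmetric : ℕ → Matrix → Set
AntidiagonalSymmetric n T = AgreeOnTriangle n T (reflect n T)

AntidiagonalZero : ℕ → Matrix → Set
AntidiagonalZero n T = ∀ i → 1 ≤ i → i + i < n → T i (suc n ∸ i) ≡ false

reflect-pascal : ∀ {n T} → Pascal n T → Pascal n (reflect n T)
reflect-pascal {n} {T} pascal i j 1≤i i<j j<n = begin
  T (n ∸ j) (n ∸ i)
    ≡⟨ xor-transpose (pascal (n ∸ j) (n ∸ i) (m<n⇒0<n∸m j<n) (∸-monoʳ-< i<j j≤n)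
                             (∸-monoʳ-< 1≤i i≤n)) ⟩
  T (suc (n ∸ j)) (suc (n ∸ i)) xor T (n ∸ j) (suc (n ∸ i))
    ≡⟨ sym (cong₂ (λ a b → T a b xor T (n ∸ j) b) (1+n∸ j≤n) (1+n∸ i≤n)) ⟩
  T (suc n ∸ j) (suc n ∸ i) xor T (n ∸ j) (suc n ∸ i)
    ∎
  where
  open ≡-Reasoning
  j≤n = <⇒≤ j<n
  i≤n = ≤-trans (<⇒≤ i<j) j≤n

pascal-unique-superdiagonal : ∀ {n T U} → Pascal n T → Pascal n U →
  (∀ k → 1 ≤ k → k < n → T k (suc k) ≡ U k (suc k)) → AgreeOnTriangle n T U
pascal-unique-superdiagonal {n} {T} {U} pT pU super i j 1≤i i<j j≤n =
  subst (λ j → T i j ≡ U i j) (m+[n∸m]≡n i<j)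
        (at-distance (j ∸ suc i) i 1≤i (subst (_≤ n) (sym (m+[n∸m]≡n i<j)) j≤n))
  where
  open ≡-Reasoning
  at-distance : ∀ d i → 1 ≤ i → suc i + d ≤ n → T i (suc i + d) ≡ U i (suc i + d)
  at-distance zero i 1≤i i<n rewrite +-identityʳ i = super i 1≤i i<n
  at-distance (suc d) i 1≤i bound rewrite +-suc i d = begin
    T i (suc k)                  ≡⟨ pascal-right {T = T} pT i k 1≤i i<k k<n ⟩
    T i k xor T (suc i) (suc k)  ≡⟨ cong₂ _xor_ (at-distance d i 1≤i (<⇒≤ k<n))
                                                (at-distance d (suc i) (s≤s z≤n) k<n) ⟩
    U i k xor U (suc i) (suc k)  ≡⟨ pascal-right {T = U} pU i k 1≤i i<k k<n ⟨
    U i (suc k)                  ∎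
    where
    k = suc (i + d)
    i<k : i < k
    i<k = s≤s (m≤m+n i d)
    k<n : suc k ≤ n
    k<n = bound

AgreeOnAntidiagonal : ℕ → Matrix → Matrix → ℕ → Set
AgreeOnAntidiagonal n T U s = ∀ i j → 1 ≤ i → i < j → j ≤ n → i + j ≡ s → T i j ≡ U i j

agree-on-next-antidiagonal : ∀ {n T U s} → Pascal n T → Pascal n U → n ≤ s →
  AgreeOnAntidiagonal n T U s → AgreeOnAntidiagonal n T U (suc s) →
  AgreeOnAntidiagonal n T U (suc (suc s))
agree-on-next-antidiagonal _ _ n≤s _ _ (suc zero) j _ _ j≤n 1+j≡2+s =
  ⊥-elim (<⇒≱ (subst (_≤ _) (suc-injective 1+j≡2+s) j≤n) n≤s)
agree-on-next-antidiagonal {T = T} {U} pT pU _ on-s on-1+s (suc i@(suc _)) (suc j) _ (s≤s i<j) j<n eq =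
  begin
    T (suc i) (suc j)       ≡⟨ pT i j 1≤i i<j j<n ⟩
    T i j xor T i (suc j)   ≡⟨ cong₂ _xor_ (on-s i j 1≤i i<j (<⇒≤ j<n) i+j≡s)
                                           (on-1+s i (suc j) 1≤i (m<n⇒m<1+n i<j) j<n i+1+j≡1+s) ⟩
    U i j xor U i (suc j)   ≡⟨ pU i j 1≤i i<j j<n ⟨
    U (suc i) (suc j)       ∎
  where
  open ≡-Reasoning
  1≤i : 1 ≤ i
  1≤i = s≤s z≤n
  i+1+j≡1+s = suc-injective eq
  i+j≡s = suc-injective (trans (sym (+-suc i j)) i+1+j≡1+s)

pascal-unique-antidiagonals : ∀ {n T U} → Pascal n T → Pascal n U →
  AgreeOnAntidiagonal n T U n → AgreeOnAntidiagonal n T U (suc n) →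
  ∀ i j → 1 ≤ i → i < j → j ≤ n → n ≤ i + j → T i j ≡ U i j
pascal-unique-antidiagonals {n} {T} {U} pT pU on-n on-1+n i j 1≤i i<j j≤n n≤i+j =
  proj₁ (from (i + j ∸ n)) i j 1≤i i<j j≤n (sym (m∸n+n≡m n≤i+j))
  where
  from : ∀ k → AgreeOnAntidiagonal n T U (k + n) × AgreeOnAntidiagonal n T U (suc (k + n))
  from zero    = on-n , on-1+n
  from (suc k) = let on-s , on-1+s = from k in
    on-1+s , agree-on-next-antidiagonal pT pU (m≤n+m n k) on-s on-1+s

antidiagonalSymmetric-upper-half : ∀ {n T} →
  (∀ i j → 1 ≤ i → i < j → j ≤ n → n ≤ i + j → T i j ≡ reflect n T i j) →
  AntidiagonalSymmetric n T
antidiagonalSymmetric-upper-half {n} {T} upper i j 1≤i i<j j≤n with n ≤? i + j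
... | yes n≤i+j = upper i j 1≤i i<j j≤n n≤i+j
-- Below the antidiagonal, the reflected pair lies above it.
... | no  n≰i+j = sym (trans
        (upper (suc n ∸ j) (suc n ∸ i) (1≤1+n∸i j≤n) (∸-monoʳ-< i<j j≤1+n) (1+n∸i≤n 1≤i)
               n≤reflected-sum)
        (cong₂ T (m∸[m∸n]≡n (≤-trans i≤n (n≤1+n n))) (m∸[m∸n]≡n j≤1+n)))
  where
  open ≤-Reasoning
  i≤n = ≤-trans (<⇒≤ i<j) j≤n
  j≤1+n = ≤-trans j≤n (n≤1+n n)
  n≤reflected-sum : n ≤ (suc n ∸ j) + (suc n ∸ i)
  n≤reflected-sum = begin
    n                          ≤⟨ n≤1+n n ⟩
    suc n                      ≡⟨ m∸n+n≡m j≤1+n ⟨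
    (suc n ∸ j) + j            ≤⟨ +-monoʳ-≤ (suc n ∸ j) (m+n≤o⇒m≤o∸n j j+i≤1+n) ⟩
    (suc n ∸ j) + (suc n ∸ i)  ∎
    where
    j+i≤1+n : j + i ≤ suc n
    j+i≤1+n = subst (_≤ suc n) (+-comm i j) (m≤n⇒m≤1+n (<⇒≤ (≰⇒> n≰i+j)))

antidiagonalZero⇒antidiagonalSymmetric : ∀ {n T} → Pascal n T → AntidiagonalZero n T →
  AntidiagonalSymmetric n T
antidiagonalZero⇒antidiagonalSymmetric {n} {T} pascal vanish =
  antidiagonalSymmetric-upper-half
    (pascal-unique-antidiagonals pascal (reflect-pascal {T = T} pascal) on-n on-1+n)
  where
  open ≡-Reasoning
  on-n : AgreeOnAntidiagonal n T (reflect n T) n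
  on-n i j 1≤i i<j j≤n i+j≡n = begin
    T i j                      ≡⟨ xor-identityʳ (T i j) ⟨
    T i j xor false            ≡⟨ cong (T i j xor_) (trans (cong (T i) (sym 1+n∸i≡1+j))
                                                           (vanish i 1≤i i+i<n)) ⟨
    T i j xor T i (suc j)      ≡⟨ pascal i j 1≤i i<j 1+j≤n ⟨
    T (suc i) (suc j)          ≡⟨ cong₂ T (reflected i j i+j≡n) 1+n∸i≡1+j ⟨
    T (suc n ∸ j) (suc n ∸ i)  ∎
    where
    reflected : ∀ a b → a + b ≡ n → suc n ∸ b ≡ suc a
    reflected a b a+b≡n = trans (cong (λ m → suc m ∸ b) (sym a+b≡n)) (m+n∸n≡m (suc a) b)
    1+n∸i≡1+j = reflected j i (trans (+-comm j i) i+j≡n)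
    i+i<n = subst (i + i <_) i+j≡n (+-monoʳ-< i i<j)
    1+j≤n = subst (suc j ≤_) (trans (+-comm j i) i+j≡n) (m<m+n j 1≤i)
  on-1+n : AgreeOnAntidiagonal n T (reflect n T) (suc n)
  on-1+n i j _ _ _ i+j≡1+n = cong₂ T
    (sym (trans (cong (_∸ j) (sym i+j≡1+n)) (m+n∸n≡m i j)))
    (sym (trans (cong (_∸ i) (sym i+j≡1+n)) (m+n∸m≡n i j)))

antidiagonalSymmetric⇒antidiagonalZero : ∀ {n T} → Pascal n T → AntidiagonalSymmetric n T →
  AntidiagonalZero n T
antidiagonalSymmetric⇒antidiagonalZero {n} {T} pascal symmetric i 1≤i i+i<n = begin
  T i (suc n ∸ i)              ≡⟨ cong (T i) (1+n∸ i≤n) ⟩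
  T i (suc j)                  ≡⟨ pascal-right {T = T} pascal i j 1≤i i<j (∸-monoʳ-< 1≤i i≤n) ⟩
  T i j xor T (suc i) (suc j)  ≡⟨ cong (_xor T (suc i) (suc j)) (symmetric i j 1≤i i<j (m∸n≤m n i)) ⟩
  T (suc n ∸ j) (suc n ∸ i) xor T (suc i) (suc j)
                               ≡⟨ cong (λ a → T a (suc n ∸ i) xor T (suc i) (suc j))
                                       (trans (1+n∸ (m∸n≤m n i)) (cong suc (m∸[m∸n]≡n i≤n))) ⟩
  T (suc i) (suc n ∸ i) xor T (suc i) (suc j)
                               ≡⟨ cong (λ b → T (suc i) b xor T (suc i) (suc j)) (1+n∸ i≤n) ⟩
  T (suc i) (suc j) xor T (suc i) (suc j) ≡⟨ xor-same (T (suc i) (suc j)) ⟩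
  false                        ∎
  where
  open ≡-Reasoning
  j = n ∸ i
  i≤n = ≤-trans (m≤m+n i i) (<⇒≤ i+i<n)
  i<j : i < j
  i<j = m+n≤o⇒m≤o∸n (suc i) i+i<n

superdiagonal : Matrix → ℕ → Bool
superdiagonal T k = T k (suc k)

Palindrome : ℕ → (ℕ → Bool) → Set
Palindrome n x = ∀ k → 1 ≤ k → k < n → x k ≡ x (n ∸ k)

palindrome⇒antidiagonalSymmetric : ∀ {n T} → Pascal n T → Palindrome n (superdiagonal T) →
  AntidiagonalSymmetric n T
palindrome⇒antidiagonalSymmetric {n} {T} pascal palindrome =
  pascal-unique-superdiagonal pascal (reflect-pascal {T = T} pascal)
    (λ k 1≤k k<n → trans (palindrome k 1≤k k<n) (cong (T (n ∸ k)) (sym (1+n∸ (<⇒≤ k<n)))))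

antidiagonalSymmetric⇒palindrome : ∀ {n T} → AntidiagonalSymmetric n T →
  Palindrome n (superdiagonal T)
antidiagonalSymmetric⇒palindrome {n} {T} symmetric k 1≤k k<n =
  trans (symmetric k (suc k) 1≤k ≤-refl k<n) (cong (T (n ∸ k)) (1+n∸ (<⇒≤ k<n)))

palindrome-cong : ∀ {n x y} → x ≗ y → Palindrome n x ⇔ Palindrome n y
palindrome-cong {n} x≗y = mk⇔
  (λ palindrome k 1≤k k<n → trans (sym (x≗y k)) (trans (palindrome k 1≤k k<n) (x≗y (n ∸ k))))
  (λ palindrome k 1≤k k<n → trans (x≗y k) (trans (palindrome k 1≤k k<n) (sym (x≗y (n ∸ k)))))

symmetricSeq⇔palindrome : ∀ {n x} → SymmetricSeq (n ∸ 1) x ⇔ Palindrome n x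
symmetricSeq⇔palindrome {zero}  = mk⇔ (λ _ _ _ ()) (λ { _ _ (s≤s _) () })
symmetricSeq⇔palindrome {suc n} {x} = mk⇔
  (λ symmetric k 1≤k k<1+n → trans (symmetric k 1≤k (s≤s⁻¹ k<1+n)) (cong x (n+1∸ n k)))
  (λ palindrome k 1≤k k≤n → trans (palindrome k 1≤k (s≤s k≤n)) (cong x (sym (n+1∸ n k))))

steinhaus⇒pascal : ∀ {n M} → Steinhaus n M → Pascal n M
steinhaus⇒pascal S i j 1≤i i<j = Steinhaus.rule S (suc i) (suc j) (s≤s 1≤i) (s≤s i<j)

rotate : Matrix → Matrix
rotate M i j = M (j ∸ i) j

rotate-pascal : ∀ {n M} → Pascal n M → Pascal n (rotate M)
rotate-pascal {M = M} pascal i j 1≤i i<j j<n =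
  trans (pascal-right {T = M} pascal (j ∸ i) j (m<n⇒0<n∸m i<j) (∸-monoʳ-< 1≤i (<⇒≤ i<j)) j<n)
        (cong (λ a → M (j ∸ i) j xor M a (suc j)) (sym (1+n∸ (<⇒≤ i<j))))

reflect-rotate : ∀ {n i j} M → i ≤ j → j ≤ n →
  reflect n (rotate M) i j ≡ M (j ∸ i) (n ∸ j + (j ∸ i) + 1)
reflect-rotate {n} {i} {j} M i≤j j≤n = cong₂ M
  (trans (cong (_∸ (suc n ∸ j)) (∸-split i≤j (m≤n⇒m≤1+n j≤n)))
         (m+n∸m≡n (suc n ∸ j) (j ∸ i)))
  (sym (trans (cong (_+ 1) (sym (∸-split i≤j j≤n)))
              (trans (+-comm (n ∸ i) 1) (sym (1+n∸ (≤-trans i≤j j≤n))))))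
  where
  ∸-split : ∀ {m i j} → i ≤ j → j ≤ m → m ∸ i ≡ (m ∸ j) + (j ∸ i)
  ∸-split {m} {i} {j} i≤j j≤m =
    trans (cong (_∸ i) (sym (m∸n+n≡m j≤m))) (+-∸-assoc (m ∸ j) i≤j)

doublySymmetric⇔antidiagonalSymmetric : ∀ {n M} → Steinhaus n M →
  DoublySymmetric n M ⇔ AntidiagonalSymmetric n M
doublySymmetric⇔antidiagonalSymmetric {n} {M} S = mk⇔
  (λ ds i j 1≤i i<j j≤n →
     trans (proj₂ (ds i j 1≤i (≤-trans (<⇒≤ i<j) j≤n) (≤-trans 1≤i (<⇒≤ i<j)) j≤n)) (reflect-n+1 i j))
  (λ symmetric i j 1≤i i≤n 1≤j j≤n → symm i j 1≤i i≤n 1≤j j≤n ,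
     trans (reflected symmetric 1≤i i≤n 1≤j j≤n (<-cmp i j)) (sym (reflect-n+1 i j)))
  where
  open Steinhaus S
  reflect-n+1 : ∀ i j → M (n + 1 ∸ j) (n + 1 ∸ i) ≡ reflect n M i j
  reflect-n+1 i j = cong₂ M (n+1∸ n j) (n+1∸ n i)
  reflected : AntidiagonalSymmetric n M → ∀ {i j} → 1 ≤ i → i ≤ n → 1 ≤ j → j ≤ n →
    Tri (i < j) (i ≡ j) (j < i) → M i j ≡ reflect n M i j
  reflected symmetric 1≤i _ _ j≤n (tri< i<j _ _) = symmetric _ _ 1≤i i<j j≤n
  reflected symmetric {i} 1≤i i≤n _ _ (tri≈ _ refl _) =
    trans (diag i 1≤i i≤n) (sym (diag (suc n ∸ i) (1≤1+n∸i i≤n) (1+n∸i≤n 1≤i)))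
  reflected symmetric {i} {j} 1≤i i≤n 1≤j j≤n (tri> _ _ j<i) =
    trans (symm i j 1≤i i≤n 1≤j j≤n) (trans (symmetric j i 1≤j j<i i≤n)
      (symm (suc n ∸ i) (suc n ∸ j) (1≤1+n∸i i≤n) (1+n∸i≤n 1≤i) (1≤1+n∸i j≤n) (1+n∸i≤n 1≤j)))

RowSymmetric : ℕ → Matrix → Set
RowSymmetric n M = ∀ i j → 1 ≤ i → i < j → j ≤ n → M i j ≡ M i (n ∸ j + i + 1)

rowSymmetric⇔antidiagonalSymmetric-rotate : ∀ {n M} →
  RowSymmetric n M ⇔ AntidiagonalSymmetric n (rotate M)
rowSymmetric⇔antidiagonalSymmetric-rotate {n} {M} = mk⇔
  (λ row i j 1≤i i<j j≤n →
     trans (row (j ∸ i) j (m<n⇒0<n∸m i<j) (∸-monoʳ-< 1≤i (<⇒≤ i<j)) j≤n)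
           (sym (reflect-rotate M (<⇒≤ i<j) j≤n)))
  (λ symmetric p q 1≤p p<q q≤n →
     let i<q = ∸-monoʳ-< 1≤p (<⇒≤ p<q) in
     subst (λ p → M p q ≡ M p (n ∸ q + p + 1)) (m∸[m∸n]≡n (<⇒≤ p<q))
           (trans (symmetric (q ∸ p) q (m<n⇒0<n∸m p<q) i<q q≤n)
                  (reflect-rotate M (<⇒≤ i<q) q≤n)))

lastColumn-palindrome : ∀ {n M} → AntidiagonalSymmetric n M → RowSymmetric n M →
  Palindrome n (lastColumn n M)
lastColumn-palindrome {n} {M} symmetric row (suc k) _ k<n = begin
  M (suc k) n                  ≡⟨ symmetric (suc k) n (s≤s z≤n) k<n ≤-refl ⟩
  M (suc n ∸ n) (n ∸ k)        ≡⟨ cong (λ a → M a (n ∸ k)) (m+n∸n≡m 1 n) ⟩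
  M 1 (n ∸ k)                  ≡⟨ row 1 (n ∸ k) ≤-refl (m+n≤o⇒m≤o∸n 2 k<n) (m∸n≤m n k) ⟩
  M 1 (n ∸ (n ∸ k) + 1 + 1)    ≡⟨ cong (M 1) n∸[n∸k]+2≡2+k ⟩
  M 1 (suc (suc k))            ≡⟨ symmetric 1 (suc (suc k)) ≤-refl (s≤s (s≤s z≤n)) k<n ⟩
  M (n ∸ suc k) n              ∎
  where
  open ≡-Reasoning
  n∸[n∸k]+2≡2+k : n ∸ (n ∸ k) + 1 + 1 ≡ 2 + k
  n∸[n∸k]+2≡2+k =
    trans (cong (λ a → a + 1 + 1) (m∸[m∸n]≡n (≤-trans (n≤1+n k) (<⇒≤ k<n))))
          (trans (+-assoc k 1 1) (+-comm k 2))

multiSymmetric⇔ : ∀ {n M} → Steinhaus n M →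
  MultiSymmetric n M ⇔ (AntidiagonalSymmetric n M × AntidiagonalSymmetric n (rotate M))
multiSymmetric⇔ S = mk⇔
  (λ (ds , row) → to doubly ds , to rows row)
  (λ (symmetric , rotated) → from doubly symmetric , from rows rotated)
  where
  open Equivalence
  doubly = doublySymmetric⇔antidiagonalSymmetric S
  rows = rowSymmetric⇔antidiagonalSymmetric-rotate

rotate-antidiagonal : ∀ n M i → rotate M i (suc n ∸ i) ≡ M (n + 1 ∸ 2 * i) (n + 1 ∸ i)
rotate-antidiagonal n M i = cong₂ M
  (trans (∸-+-assoc (suc n) i i) (sym (trans (n+1∸ n (2 * i)) (cong (suc n ∸_) (2*i≡i+i i)))))
  (sym (n+1∸ n i))

antidiagonalZero⇒conditionIII : ∀ {n M} → 1 ≤ n → DoublySymmetric n M →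
  AntidiagonalZero n M → AntidiagonalZero n (rotate M) → ConditionIII n M
antidiagonalZero⇒conditionIII {n} {M} 1≤n ds vanish rotated-vanish i 1≤i i≤half =
  trans (cong (M i) (n+1∸ n i)) (vanish i 1≤i i+i<n) ,
  rotated-corner ,
  trans (proj₂ (ds i (2 * i) 1≤i i≤n (≤-trans 1≤i (m≤m+n i _)) 2*i≤n)) rotated-corner
  where
  i+i<n = Equivalence.to (≤-half⇔ 1≤n) i≤half
  i≤n = ≤-trans (m≤m+n i i) (<⇒≤ i+i<n)
  2*i≤n = subst (_≤ n) (sym (2*i≡i+i i)) (<⇒≤ i+i<n)
  rotated-corner = trans (sym (rotate-antidiagonal n M i)) (rotated-vanish i 1≤i i+i<n)

conditionIII⇒antidiagonalZero : ∀ {n M} → 1 ≤ n → ConditionIII n M →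
  AntidiagonalZero n M × AntidiagonalZero n (rotate M)
conditionIII⇒antidiagonalZero {n} {M} 1≤n iii =
    (λ i 1≤i i+i<n → trans (cong (M i) (sym (n+1∸ n i))) (proj₁ (iii i 1≤i (half i+i<n))))
  , (λ i 1≤i i+i<n → trans (rotate-antidiagonal n M i) (proj₁ (proj₂ (iii i 1≤i (half i+i<n)))))
  where
  half : ∀ {i} → i + i < n → i ≤ (n ∸ 1) / 2
  half = Equivalence.from (≤-half⇔ 1≤n)

proposition3 : (n : ℕ) → 3 ≤ n → (M : Matrix) → Steinhaus n M →
    (MultiSymmetric n M ⇔ ConditionII n M) × (MultiSymmetric n M ⇔ ConditionIII n M)
proposition3 n 3≤n M S = mk⇔ ms⇒ii ii⇒ms , mk⇔ ms⇒iii iii⇒ms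
  where
  open Equivalence
  pascal = steinhaus⇒pascal S
  rotated = rotate-pascal {M = M} pascal
  1≤n = ≤-trans (s≤s z≤n) 3≤n
  first-row : superdiagonal (rotate M) ≗ firstRow M
  first-row k = cong₂ M (m+n∸n≡m 1 k) (+-comm 1 k)
  over-diagonal : superdiagonal M ≗ overDiagonal M
  over-diagonal k = cong (M k) (+-comm 1 k)

  ms⇒ii : MultiSymmetric n M → ConditionII n M
  ms⇒ii multi@(_ , row) =
    let symmetric , rotated-symmetric = to (multiSymmetric⇔ S) multi in
      from symmetricSeq⇔palindrome
        (to (palindrome-cong first-row) (antidiagonalSymmetric⇒palindrome rotated-symmetric))
    , from symmetricSeq⇔palindrome (lastColumn-palindrome symmetric row)
    , from symmetricSeq⇔palindrome
        (to (palindrome-cong over-diagonal) (antidiagonalSymmetric⇒palindrome symmetric))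

  ii⇒ms : ConditionII n M → MultiSymmetric n M
  ii⇒ms (first , _ , over) = from (multiSymmetric⇔ S)
    ( palindrome⇒antidiagonalSymmetric pascal
        (from (palindrome-cong over-diagonal) (to symmetricSeq⇔palindrome over))
    , palindrome⇒antidiagonalSymmetric rotated
        (from (palindrome-cong first-row) (to symmetricSeq⇔palindrome first)))

  ms⇒iii : MultiSymmetric n M → ConditionIII n M
  ms⇒iii multi@(ds , _) =
    let symmetric , rotated-symmetric = to (multiSymmetric⇔ S) multi in
    antidiagonalZero⇒conditionIII 1≤n ds
      (antidiagonalSymmetric⇒antidiagonalZero pascal symmetric)
      (antidiagonalSymmetric⇒antidiagonalZero rotated rotated-symmetric)

  iii⇒ms : ConditionIII n M → MultiSymmetric n M
  iii⇒ms iii =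
    let vanish , rotated-vanish = conditionIII⇒antidiagonalZero {M = M} 1≤n iii in
    from (multiSymmetric⇔ S)
      ( antidiagonalZero⇒antidiagonalSymmetric pascal vanish
      , antidiagonalZero⇒antidiagonalSymmetric rotated rotated-vanish)
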